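{- Let $r,t$ be positive integers and let $\mathcal{H}$ be an $r$-graph that is simultaneously $\mathscr{G}_r\!\left(tr+\lceil\frac{2r-t-1}{t+2}\rceil,\,t+2\right)$-free and $\mathscr{G}_r\!\left(2r-\lceil\frac{2r-t-1}{t+2}\rceil-1,\,2\right)$-free. Then $\mathcal{H}$ is $t$-cancellative.
   Context: An $r$-graph is a family of distinct $r$-element subsets (edges) of a finite vertex set. For integers $v,e$, an $r$-graph is $\mathscr{G}_r(v,e)$-free if the union of any $e$ distinct edges contains at least $v+1$ vertices. An $r$-graph $\mathcal{H}$ is $t$-cancellative if for any $t+2$ distinct edges $A_1,\dots,A_t,B,C\in\mathcal{H}$ one has $(\cup_{i=1}^t A_i)\cup B\neq(\cup_{i=1}^t A_i)\cup C$. -}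

module Defs where

open import Data.Nat using (ℕ; suc; _+_; _*_; _∸_; _/_; _≤_)
open import Data.Fin using (Fin) renaming (zero to fzero; suc to fsuc)
open import Data.Fin.Subset using (Subset; _∪_; ⊥; ∣_∣)
open import Data.Product using (_×_)
open import Data.Empty using () renaming (⊥ to Empty)
open import Relation.Nullary using (¬_)
open import Relation.Binary.PropositionalEquality using (_≡_; _≢_)
open import Function.Definitions using (Injective)

⋃ᶠ : ∀ {n k} → (Fin k → Subset n) → Subset n
⋃ᶠ {k = 0}     f = ⊥
⋃ᶠ {k = suc k} f = f fzero ∪ ⋃ᶠ (λ i → f (fsuc i))

record RGraph (r n m : ℕ) : Set where
  field
    edge     : Fin m → Subset n
    uniform  : ∀ i → ∣ edge i ∣ ≡ r
    distinct : Injective _≡_ _≡_ edge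

open RGraph public

-- G_r(v,e)-free: the union of any e distinct edges has at least v+1 vertices.
-- "e distinct edges" = an injective choice Fin e → Fin m of edge indices.
GFree : ∀ {r n m} → RGraph r n m → ℕ → ℕ → Set
GFree {m = m} H v e =
  (σ : Fin e → Fin m) → Injective _≡_ _≡_ σ →
  suc v ≤ ∣ ⋃ᶠ (λ i → edge H (σ i)) ∣

Cancellative : ∀ {r n m} → ℕ → RGraph r n m → Set
Cancellative {m = m} t H =
  (A : Fin t → Fin m) (b c : Fin m) →
  Injective _≡_ _≡_ A →
  (∀ i → A i ≢ b) → (∀ i → A i ≢ c) → b ≢ c →
  (⋃ᶠ (λ i → edge H (A i)) ∪ edge H b) ≢ (⋃ᶠ (λ i → edge H (A i)) ∪ edge H c)

-- ⌈ (2r - t - 1) / (t + 2) ⌉ for positive r, t.  When 2r - t - 1 < 0 the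
-- rational value lies in (-1, 0], so its ceiling is 0, matching truncated ∸.
ceilTerm : ℕ → ℕ → ℕ
ceilTerm r t = ((2 * r ∸ t ∸ 1) + (t + 1)) / suc (suc t)

module Submission where

-- Suppose A₁,…,A_t,B,C are distinct edges with U ∪ B = U ∪ C, where
-- U = A₁ ∪ … ∪ A_t, and write k = ⌈(2r-t-1)/(t+2)⌉.  Every vertex of B lies in U
-- or in C, and symmetrically, so the union of all t+2 edges is contained in
-- U ∪ (B ∩ C), which has at most t·r + |B ∩ C| vertices.  The first freeness
-- hypothesis then forces |B ∩ C| > k.  On the other hand the second freeness
-- hypothesis says |B ∪ C| ≥ 2r - k, and |B ∪ C| + |B ∩ C| = |B| + |C| = 2r
-- gives |B ∩ C| ≤ k, a contradiction.  (Nothing about k beyond these two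
-- inequalities is used, so the argument works for an arbitrary k.)

open import Defs
open import Data.Nat using (ℕ; _+_; _*_; _∸_; _≤_; _<_; zero; suc; z≤n)
open import Data.Nat.Properties
open import Data.Bool using (true; false)
open import Data.Vec using ([]; _∷_)
open import Data.Fin using (Fin; splitAt; join) renaming (zero to fzero; suc to fsuc)
open import Data.Fin.Properties using (join-splitAt)
open import Data.Fin.Subset using (Subset; _∪_; _∩_; _∈_; _⊆_; ∣_∣)
open import Data.Fin.Subset.Properties
open import Data.Sum using (_⊎_; inj₁; inj₂; [_,_]′)
open import Data.Product using (_,_; ∃)
open import Data.Empty using (⊥-elim)
open import Relation.Nullary using (contradiction)
open import Relation.Binary.PropositionalEquality
open import Function.Definitions using (Injective)

∣p∪q∣+∣p∩q∣≡∣p∣+∣q∣ : ∀ {n} (p q : Subset n) → ∣ p ∪ q ∣ + ∣ p ∩ q ∣ ≡ ∣ p ∣ + ∣ q ∣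
∣p∪q∣+∣p∩q∣≡∣p∣+∣q∣ []         []         = refl
∣p∪q∣+∣p∩q∣≡∣p∣+∣q∣ (true ∷ p) (true ∷ q) = cong suc (begin
  ∣ p ∪ q ∣ + suc ∣ p ∩ q ∣   ≡⟨ +-suc ∣ p ∪ q ∣ ∣ p ∩ q ∣ ⟩
  suc (∣ p ∪ q ∣ + ∣ p ∩ q ∣) ≡⟨ cong suc (∣p∪q∣+∣p∩q∣≡∣p∣+∣q∣ p q) ⟩
  suc (∣ p ∣ + ∣ q ∣)         ≡⟨ +-suc ∣ p ∣ ∣ q ∣ ⟨
  ∣ p ∣ + suc ∣ q ∣           ∎)
  where open ≡-Reasoning
∣p∪q∣+∣p∩q∣≡∣p∣+∣q∣ (true ∷ p)  (false ∷ q) = cong suc (∣p∪q∣+∣p∩q∣≡∣p∣+∣q∣ p q)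
∣p∪q∣+∣p∩q∣≡∣p∣+∣q∣ (false ∷ p) (true ∷ q)  =
  trans (cong suc (∣p∪q∣+∣p∩q∣≡∣p∣+∣q∣ p q)) (sym (+-suc ∣ p ∣ ∣ q ∣))
∣p∪q∣+∣p∩q∣≡∣p∣+∣q∣ (false ∷ p) (false ∷ q) = ∣p∪q∣+∣p∩q∣≡∣p∣+∣q∣ p q

∣p∪q∣≤∣p∣+∣q∣ : ∀ {n} (p q : Subset n) → ∣ p ∪ q ∣ ≤ ∣ p ∣ + ∣ q ∣
∣p∪q∣≤∣p∣+∣q∣ p q = subst (∣ p ∪ q ∣ ≤_) (∣p∪q∣+∣p∩q∣≡∣p∣+∣q∣ p q) (m≤m+n _ _)

small-intersection : ∀ {n} (p q : Subset n) {s k : ℕ} → ∣ p ∣ + ∣ q ∣ ≡ s →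
  suc (s ∸ k ∸ 1) ≤ ∣ p ∪ q ∣ → ∣ p ∩ q ∣ ≤ k
small-intersection p q {s} {k} size large = +-cancelʳ-≤ (s ∸ k) ∣ p ∩ q ∣ k (begin
  ∣ p ∩ q ∣ + (s ∸ k)         ≤⟨ +-monoʳ-≤ ∣ p ∩ q ∣ (≤-trans (m≤suc[m∸1] (s ∸ k)) large) ⟩
  ∣ p ∩ q ∣ + ∣ p ∪ q ∣       ≡⟨ +-comm ∣ p ∩ q ∣ ∣ p ∪ q ∣ ⟩
  ∣ p ∪ q ∣ + ∣ p ∩ q ∣       ≡⟨ trans (∣p∪q∣+∣p∩q∣≡∣p∣+∣q∣ p q) size ⟩
  s                           ≤⟨ m≤n+m∸n s k ⟩
  k + (s ∸ k)                 ∎)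
  where
  open ≤-Reasoning
  m≤suc[m∸1] : ∀ m → m ≤ suc (m ∸ 1)
  m≤suc[m∸1] zero    = z≤n
  m≤suc[m∸1] (suc m) = ≤-refl

∈⋃ᶠ⁻ : ∀ {n k} (f : Fin k → Subset n) {x} → x ∈ ⋃ᶠ f → ∃ λ i → x ∈ f i
∈⋃ᶠ⁻ {k = zero}  f x∈ = contradiction x∈ ∉⊥
∈⋃ᶠ⁻ {k = suc k} f x∈ with x∈p∪q⁻ (f fzero) (⋃ᶠ (λ i → f (fsuc i))) x∈
... | inj₁ x∈f₀ = fzero , x∈f₀
... | inj₂ x∈⋃ with ∈⋃ᶠ⁻ (λ i → f (fsuc i)) x∈⋃
...   | i , x∈fᵢ = fsuc i , x∈fᵢ

∈⋃ᶠ⁺ : ∀ {n k} (f : Fin k → Subset n) {x} i → x ∈ f i → x ∈ ⋃ᶠ f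
∈⋃ᶠ⁺ f fzero    x∈ = x∈p∪q⁺ (inj₁ x∈)
∈⋃ᶠ⁺ f (fsuc i) x∈ = x∈p∪q⁺ (inj₂ (∈⋃ᶠ⁺ (λ j → f (fsuc j)) i x∈))

∣⋃ᶠ∣≤k*r : ∀ {n k} r (f : Fin k → Subset n) → (∀ i → ∣ f i ∣ ≡ r) → ∣ ⋃ᶠ f ∣ ≤ k * r
∣⋃ᶠ∣≤k*r {n} {zero}  r f size = ≤-reflexive (∣⊥∣≡0 n)
∣⋃ᶠ∣≤k*r {k = suc k} r f size = ≤-trans (∣p∪q∣≤∣p∣+∣q∣ (f fzero) _)
  (+-mono-≤ (≤-reflexive (size fzero)) (∣⋃ᶠ∣≤k*r r (λ i → f (fsuc i)) (λ i → size (fsuc i))))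

append : ∀ {k l} {X : Set} → (Fin k → X) → (Fin l → X) → Fin (k + l) → X
append {k} f g i = [ f , g ]′ (splitAt k i)

append-injective : ∀ {k l} {X : Set} {f : Fin k → X} {g : Fin l → X} →
  Injective _≡_ _≡_ f → Injective _≡_ _≡_ g → (∀ i j → f i ≢ g j) →
  Injective _≡_ _≡_ (append f g)
append-injective {k} {l} {f = f} {g} f-inj g-inj disjoint {i} {j} eq = begin
  i                      ≡⟨ join-splitAt k l i ⟨
  join k l (splitAt k i) ≡⟨ cong (join k l) (sum-injective (splitAt k i) (splitAt k j) eq) ⟩
  join k l (splitAt k j) ≡⟨ join-splitAt k l j ⟩
  j                      ∎
  where
  open ≡-Reasoning
  sum-injective : ∀ u v → [ f , g ]′ u ≡ [ f , g ]′ v → u ≡ v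
  sum-injective (inj₁ a) (inj₁ b) e = cong inj₁ (f-inj e)
  sum-injective (inj₁ a) (inj₂ b) e = ⊥-elim (disjoint a b e)
  sum-injective (inj₂ a) (inj₁ b) e = ⊥-elim (disjoint b a (sym e))
  sum-injective (inj₂ a) (inj₂ b) e = cong inj₂ (g-inj e)

⋃ᶠ-append⊆ : ∀ {n k l} {X : Set} (F : X → Subset n) (f : Fin k → X) (g : Fin l → X) →
  ⋃ᶠ (λ i → F (append f g i)) ⊆ ⋃ᶠ (λ i → F (f i)) ∪ ⋃ᶠ (λ i → F (g i))
⋃ᶠ-append⊆ {k = k} F f g x∈ with ∈⋃ᶠ⁻ (λ i → F (append f g i)) x∈
... | i , x∈Fᵢ with splitAt k i
...   | inj₁ a = x∈p∪q⁺ (inj₁ (∈⋃ᶠ⁺ (λ j → F (f j)) a x∈Fᵢ))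
...   | inj₂ b = x∈p∪q⁺ (inj₂ (∈⋃ᶠ⁺ (λ j → F (g j)) b x∈Fᵢ))

pair : ∀ {X : Set} → X → X → Fin 2 → X
pair b c fzero    = b
pair b c (fsuc _) = c

pair-injective : ∀ {X : Set} {b c : X} → b ≢ c → Injective _≡_ _≡_ (pair b c)
pair-injective b≢c {fzero}       {fzero}       e = refl
pair-injective b≢c {fzero}       {fsuc fzero}  e = ⊥-elim (b≢c e)
pair-injective b≢c {fsuc fzero}  {fzero}       e = ⊥-elim (b≢c (sym e))
pair-injective b≢c {fsuc fzero}  {fsuc fzero}  e = refl

cancellation-collapse : ∀ {n} (U B C : Subset n) → U ∪ B ≡ U ∪ C →
  U ∪ (B ∪ C) ⊆ U ∪ (B ∩ C)
cancellation-collapse U B C eq {x} x∈ = [ inU , inB∪C ]′ (x∈p∪q⁻ U (B ∪ C) x∈)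
  where
  inU : x ∈ U → x ∈ U ∪ (B ∩ C)
  inU x∈U = x∈p∪q⁺ (inj₁ x∈U)
  land : ∀ {D} → x ∈ U ∪ D → (x ∈ D → x ∈ B ∩ C) → x ∈ U ∪ (B ∩ C)
  land x∈U∪D D→B∩C = [ inU , (λ x∈D → x∈p∪q⁺ (inj₂ (D→B∩C x∈D))) ]′ (x∈p∪q⁻ U _ x∈U∪D)
  inB∪C : x ∈ B ∪ C → x ∈ U ∪ (B ∩ C)
  inB∪C x∈B∪C = [ (λ x∈B → land (subst (x ∈_) eq (x∈p∪q⁺ (inj₂ x∈B))) (λ x∈C → x∈p∩q⁺ (x∈B , x∈C)))
                , (λ x∈C → land (subst (x ∈_) (sym eq) (x∈p∪q⁺ (inj₂ x∈C))) (λ x∈B → x∈p∩q⁺ (x∈B , x∈C)))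
                ]′ (x∈p∪q⁻ B C x∈B∪C)

-- In a G_r(t·r + k, t + 2)-free r-graph, if edges
-- A₁,…,A_t,B,C are distinct and (⋃ Aᵢ) ∪ B = (⋃ Aᵢ) ∪ C, then |B ∩ C| > k:
-- all t+2 edges lie inside (⋃ Aᵢ) ∪ (B ∩ C), of size at most t·r + |B ∩ C|.
cancellation⇒large-overlap : ∀ {r n m} (H : RGraph r n m) t k →
  GFree H (t * r + k) (t + 2) →
  (A : Fin t → Fin m) (b c : Fin m) → Injective _≡_ _≡_ A →
  (∀ i → A i ≢ b) → (∀ i → A i ≢ c) → b ≢ c →
  ⋃ᶠ (λ i → edge H (A i)) ∪ edge H b ≡ ⋃ᶠ (λ i → edge H (A i)) ∪ edge H c →
  k < ∣ edge H b ∩ edge H c ∣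
cancellation⇒large-overlap {r} {m = m} H t k free A b c A-inj A≢b A≢c b≢c eq =
  +-cancelˡ-< (t * r) k ∣ B ∩ C ∣ (begin-strict
    t * r + k                               <⟨ free σ σ-injective ⟩
    ∣ ⋃ᶠ (λ i → edge H (σ i)) ∣             ≤⟨ p⊆q⇒∣p∣≤∣q∣ all⊆U∪B∩C ⟩
    ∣ U ∪ (B ∩ C) ∣                         ≤⟨ ∣p∪q∣≤∣p∣+∣q∣ U (B ∩ C) ⟩
    ∣ U ∣ + ∣ B ∩ C ∣                       ≤⟨ +-monoˡ-≤ ∣ B ∩ C ∣ U-size ⟩
    t * r + ∣ B ∩ C ∣                       ∎)
  where
  open ≤-Reasoning
  U = ⋃ᶠ (λ i → edge H (A i))
  B = edge H b
  C = edge H c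
  σ : Fin (t + 2) → Fin m
  σ = append A (pair b c)
  σ-injective : Injective _≡_ _≡_ σ
  σ-injective = append-injective A-inj (pair-injective b≢c) A≢pair
    where
    A≢pair : ∀ i j → A i ≢ pair b c j
    A≢pair i fzero    = A≢b i
    A≢pair i (fsuc _) = A≢c i
  U-size : ∣ U ∣ ≤ t * r
  U-size = ∣⋃ᶠ∣≤k*r r (λ i → edge H (A i)) (λ i → uniform H (A i))
  all⊆U∪B∩C : ⋃ᶠ (λ i → edge H (σ i)) ⊆ U ∪ (B ∩ C)
  all⊆U∪B∩C x∈ = cancellation-collapse U B C eq
    (subst (λ D → _ ∈ U ∪ (B ∪ D)) (∪-identityʳ C) (⋃ᶠ-append⊆ (edge H) A (pair b c) x∈))

pair-free⇒small-overlap : ∀ {r n m} (H : RGraph r n m) k →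
  GFree H (2 * r ∸ k ∸ 1) 2 →
  ∀ {b c} → b ≢ c → ∣ edge H b ∩ edge H c ∣ ≤ k
pair-free⇒small-overlap {r} H k free {b} {c} b≢c =
  small-intersection (edge H b) (edge H c) sizes
    (subst (λ D → _ ≤ ∣ edge H b ∪ D ∣) (∪-identityʳ (edge H c))
      (free (pair b c) (pair-injective b≢c)))
  where
  sizes : ∣ edge H b ∣ + ∣ edge H c ∣ ≡ 2 * r
  sizes = trans (cong₂ _+_ (uniform H b) (uniform H c)) (cong (r +_) (sym (+-identityʳ r)))

lemma2 : (r t n m : ℕ) → 1 ≤ r → 1 ≤ t → (H : RGraph r n m) →
    GFree H (t * r + ceilTerm r t) (t + 2) →
    GFree H (2 * r ∸ ceilTerm r t ∸ 1) 2 →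
    Cancellative t H
lemma2 r t n m _ _ H free-t+2 free-2 A b c A-inj A≢b A≢c b≢c eq =
  <⇒≱ (cancellation⇒large-overlap H t (ceilTerm r t) free-t+2 A b c A-inj A≢b A≢c b≢c eq)
      (pair-free⇒small-overlap H (ceilTerm r t) free-2 b≢c)
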